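{- Let $G=([n],E)$ be a natural unit interval graph and let $T$ be a decreasing subtree of $G$ whose vertex set contains a cut vertex $c$ of $G$. Then the word $\sigma=\mathrm{list}(T)$ consists of all vertices of $T$ that are at most $c$ (in some order), followed by all vertices of $T$ that are strictly greater than $c$ (in some order).
   Context: A graph $G=([n],E)$ is a natural unit interval graph if for all $1\le i<j<k\le n$, $\{i,k\}\in E$ implies $\{i,j\}\in E$ and $\{j,k\}\in E$. A cut vertex of $G$ is a vertex whose removal increases the number of connected components. A decreasing subtree of $G$ is a subgraph $T$ of $G$ which is a tree (with nonempty vertex set) such that every vertex of $T$ other than the largest vertex of $T$ has exactly one neighbour in $T$ larger than itself. $\mathrm{list}(T)$ is the permutation of $V(T)$ obtained by reading first the smallest vertex of $T$, and at each subsequent step reading the smallest unread vertex of $T$ adjacent in $T$ to an already read vertex. -}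

module Defs where

open import Data.Nat using (ℕ)
open import Data.Fin using (Fin; _<_; _≤_)
open import Data.List using (List; []; _∷_; _++_)
open import Data.List.Relation.Unary.Any using (Any)
open import Data.List.Relation.Unary.All using (All)
open import Data.List.Relation.Unary.Linked using (Linked)
open import Data.List.Relation.Unary.Unique.Propositional using (Unique)
open import Data.List.Membership.Propositional using (_∈_; _∉_)
open import Data.List.Base using (length; head; last)
open import Data.Maybe using (just)
open import Data.Product using (Σ; ∃; _×_; _,_)
open import Data.Sum using (_⊎_)
open import Relation.Nullary using (¬_)
open import Relation.Binary.PropositionalEquality using (_≡_; _≢_)
open import Function.Bundles using (_⇔_)
open import Data.Unit using (⊤)
open import Data.Nat using () renaming (_<_ to _<ℕ_)

-- A simple graph on the vertex set [n], modelled as Fin n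
-- (vertex i of the paper is Fin element i-1; the order is preserved).
record Graph (n : ℕ) : Set₁ where
  field
    Adj    : Fin n → Fin n → Set
    sym    : ∀ {u v} → Adj u v → Adj v u
    irrefl : ∀ {u} → ¬ Adj u u
open Graph public

NaturalUnitInterval : ∀ {n} → Graph n → Set
NaturalUnitInterval {n} G =
  ∀ (i j k : Fin n) → i < j → j < k → Adj G i k → Adj G i j × Adj G j k

data Reach {n : ℕ} (R : Fin n → Fin n → Set) (S : Fin n → Set) (u : Fin n) : Fin n → Set where
  here : S u → Reach R S u u
  step : ∀ {w v} → Reach R S u w → R w v → S v → Reach R S u v

-- The induced subgraph of G on S has exactly k connected components:
-- a surjective labelling of S by Fin k identifying exactly reachable vertices.
HasComponents : ∀ {n} → Graph n → (Fin n → Set) → ℕ → Set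
HasComponents {n} G S k =
  Σ ((v : Fin n) → S v → Fin k) λ f →
    (∀ (i : Fin k) → Σ (Fin n) λ v → Σ (S v) λ p → f v p ≡ i) ×
    (∀ u (p : S u) v (q : S v) → (f u p ≡ f v q) ⇔ Reach (Adj G) S u v)

AllVertices : ∀ {n} → Fin n → Set
AllVertices _ = ⊤

Without : ∀ {n} → Fin n → Fin n → Set
Without c v = v ≢ c

IsCutVertex : ∀ {n} → Graph n → Fin n → Set
IsCutVertex G c =
  Σ ℕ λ k → Σ ℕ λ k' →
    HasComponents G AllVertices k × HasComponents G (Without c) k' × k <ℕ k'

record Subgraph {n : ℕ} (G : Graph n) : Set₁ where
  field
    V      : Fin n → Set
    E      : Fin n → Fin n → Set
    E⊆G    : ∀ {u v} → E u v → Adj G u v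
    E-src  : ∀ {u v} → E u v → V u
    E-sym  : ∀ {u v} → E u v → E v u
open Subgraph public

IsCycle : ∀ {n} {G : Graph n} → Subgraph G → List (Fin n) → Set
IsCycle T cs =
  (2 <ℕ length cs) × Unique cs × Linked (E T) cs ×
  Σ _ λ x → Σ _ λ y → head cs ≡ just x × last cs ≡ just y × E T y x

IsTree : ∀ {n} {G : Graph n} → Subgraph G → Set
IsTree {n} T =
  (Σ (Fin n) λ v → V T v) ×
  (∀ u v → V T u → V T v → Reach (E T) (V T) u v) ×
  (∀ cs → ¬ IsCycle T cs)

IsDecreasingSubtree : ∀ {n} {G : Graph n} → Subgraph G → Set
IsDecreasingSubtree {n} T =
  IsTree T ×
  (∀ v → V T v → (Σ (Fin n) λ w → V T w × v < w) →
     Σ (Fin n) λ u → (E T v u × v < u) ×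
       (∀ u' → E T v u' → v < u' → u' ≡ u))

-- The vertices that may be read after the (already read) prefix pre:
-- unread vertices of T, adjacent in T to a read vertex (any vertex of T
-- at the very first step).
Candidate : ∀ {n} {G : Graph n} → Subgraph G → List (Fin n) → Fin n → Set
Candidate T pre z = V T z × z ∉ pre × (pre ≡ [] ⊎ Any (λ y → E T y z) pre)

-- σ = list(T): at each step the read vertex is the smallest candidate,
-- and every vertex of T is eventually read.
IsList : ∀ {n} {G : Graph n} → Subgraph G → List (Fin n) → Set
IsList {n} T σ =
  (∀ pre x post → σ ≡ pre ++ x ∷ post →
     Candidate T pre x × (∀ z → Candidate T pre z → x ≤ z)) ×
  (∀ v → V T v → v ∈ σ)

-- In a natural unit interval graph no edge i–k with i < c < k can
-- jump over a cut vertex c: such an edge would make every neighbour of c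
-- reachable from i without passing through c, so deleting c would not
-- disconnect anything. Hence no edge of T jumps over c either, and the vertices
-- of T that are ≤ c span a connected subgraph of T. While list(T) has read
-- only vertices ≤ c and some vertex ≤ c of T is unread, that subgraph has an
-- edge leaving the read set, which yields a candidate ≤ c; since list(T) reads
-- the smallest candidate, all vertices ≤ c are read before any vertex > c.
module Submission where

open import Defs
open import Data.Nat using (ℕ)
open import Data.Fin using (Fin; _<_; _≤_)
open import Data.List using (List; _++_)
open import Data.List.Relation.Unary.All using (All)
open import Data.Product using (Σ; _×_)
open import Relation.Binary.PropositionalEquality using (_≡_)

open import Data.Nat using () renaming (_≤_ to _≤ℕ_; _<_ to _<ℕ_)
import Data.Nat.Properties as ℕ
open import Data.Fin using (_≟_; _≤?_)
open import Data.Fin.Properties using (<-cmp; <⇒≢; ≤∧≢⇒<; pigeonhole)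
open import Data.List using ([]; _∷_; [_]; head; takeWhile; dropWhile)
open import Data.List.Properties using (++-assoc; takeWhile++dropWhile)
open import Data.List.Membership.Propositional using (_∈_; _∉_)
import Data.List.Membership.DecPropositional as DecMembership
open import Data.List.Membership.Propositional.Properties using (∈-++⁺ˡ)
open import Data.List.Relation.Unary.All using ([]; _∷_)
import Data.List.Relation.Unary.All as All
open import Data.List.Relation.Unary.All.Properties using (all-takeWhile; all-head-dropWhile)
import Data.List.Relation.Unary.Any as Any
import Data.Maybe.Relation.Unary.All as Maybe
open import Data.Product using (_,_; proj₁; proj₂; ∃₂)
open import Data.Sum using (_⊎_; inj₁; inj₂)
open import Data.Unit using (tt)
open import Relation.Nullary using (¬_; yes; no; contradiction)
open import Relation.Unary using (Decidable)
open import Relation.Binary using (tri<; tri≈; tri>)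
open import Relation.Binary.PropositionalEquality using (_≢_; refl)
import Relation.Binary.PropositionalEquality as ≡
open import Function using (_∘_)
open import Function.Bundles using (Equivalence)

module _ {n : ℕ} {R : Fin n → Fin n → Set} {S : Fin n → Set} where

  Reach-target : ∀ {u v} → Reach R S u v → S v
  Reach-target (here s)     = s
  Reach-target (step _ _ s) = s

  Reach-trans : ∀ {u v w} → Reach R S u v → Reach R S v w → Reach R S u w
  Reach-trans p (here _)     = p
  Reach-trans p (step q e s) = step (Reach-trans p q) e s

  Reach-reverse : (∀ {a b} → R a b → R b a) → ∀ {u v} → Reach R S u v → Reach R S v u
  Reach-reverse R-sym (here s)     = here s
  Reach-reverse R-sym (step p e s) =
    Reach-trans (step (here s) (R-sym e) (Reach-target p)) (Reach-reverse R-sym p)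

  Reach-exit : {P : Fin n → Set} → Decidable P → ∀ {u v} → Reach R S u v → P u → ¬ P v →
               ∃₂ λ w w' → P w × ¬ P w' × R w w' × S w'
  Reach-exit P? (here _) pu ¬pv = contradiction pu ¬pv
  Reach-exit P? (step {w} {w'} p e s) pu ¬pw' with P? w
  ... | yes pw = w , w' , pw , ¬pw' , e , s
  ... | no ¬pw = Reach-exit P? p pu ¬pw

NoEdgeOver : ∀ {n} → (Fin n → Fin n → Set) → Fin n → Set
NoEdgeOver R c = ∀ {i k} → i < c → c < k → ¬ R i k

module _ {n} (G : Graph n) where

  components-≤ : ∀ {A B : Fin n → Set} {k k'} →
                 HasComponents G A k → HasComponents G B k' → (∀ {v} → B v → A v) →
                 (∀ {u v} → B u → B v → Reach (Adj G) A u v → Reach (Adj G) B u v) →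
                 k' ≤ℕ k
  components-≤ {k = k} {k'} (f , _ , f-reach) (g , g-onto , g-reach) B⊆A B-closed =
    ℕ.≮⇒≥ collision
    where
      collision : ¬ k <ℕ k'
      collision k<k' with pigeonhole k<k' (λ j → f _ (B⊆A (proj₁ (proj₂ (g-onto j)))))
      ... | j , j' , j<j' , same-f with g-onto j | g-onto j'
      ... | u , bu , refl | v , bv , refl =
        <⇒≢ j<j' (Equivalence.from (g-reach u bu v bv)
          (B-closed bu bv (Equivalence.to (f-reach u (B⊆A bu) v (B⊆A bv)) same-f)))

  module _ (nui : NaturalUnitInterval G) {c i k : Fin n}
           (i<c : i < c) (c<k : c < k) (i~k : Adj G i k) where

    private
      i≢c : i ≢ c
      i≢c = <⇒≢ i<c

      k≢c : k ≢ c
      k≢c refl = <⇒≢ c<k refl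

    neighbour-reaches-over-edge : ∀ {a} → Adj G a c → a ≢ c → Reach (Adj G) (Without c) a i
    neighbour-reaches-over-edge {a} a~c a≢c with <-cmp a i
    ... | tri< a<i _ _ = step (here a≢c) (proj₁ (nui a i c a<i i<c a~c)) i≢c
    ... | tri≈ _ refl _ = here a≢c
    ... | tri> _ _ i<a with <-cmp a k
    ...   | tri< a<k _ _ = step (here a≢c) (Graph.sym G (proj₁ (nui i a k i<a a<k i~k))) i≢c
    ...   | tri≈ _ refl _ = step (here a≢c) (Graph.sym G i~k) i≢c
    ...   | tri> _ _ k<a =
            step (step (here a≢c) (Graph.sym G (proj₂ (nui c k a c<k k<a (Graph.sym G a~c)))) k≢c)
                 (Graph.sym G i~k) i≢c

    -- A walk through c is rerouted through i, which all neighbours of c reach.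
    Reach-avoiding : ∀ {u v} → u ≢ c → Reach (Adj G) AllVertices u v →
                     (v ≡ c × Reach (Adj G) (Without c) u i) ⊎ Reach (Adj G) (Without c) u v
    Reach-avoiding u≢c (here _) = inj₂ (here u≢c)
    Reach-avoiding u≢c (step {w} {v} p w~v _) with Reach-avoiding u≢c p | v ≟ c
    ... | inj₁ (refl , _) | yes refl = contradiction w~v (irrefl G)
    ... | inj₁ (refl , u→i) | no v≢c =
          inj₂ (Reach-trans u→i (Reach-reverse (Graph.sym G)
                  (neighbour-reaches-over-edge (Graph.sym G w~v) v≢c)))
    ... | inj₂ u→w | yes refl =
          inj₁ (refl , Reach-trans u→w (neighbour-reaches-over-edge w~v (Reach-target u→w)))
    ... | inj₂ u→w | no v≢c = inj₂ (step u→w w~v v≢c)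

    Reach-without : ∀ {u v} → u ≢ c → v ≢ c →
                    Reach (Adj G) AllVertices u v → Reach (Adj G) (Without c) u v
    Reach-without u≢c v≢c p with Reach-avoiding u≢c p
    ... | inj₁ (v≡c , _) = contradiction v≡c v≢c
    ... | inj₂ u→v       = u→v

  cutVertex⇒noEdgeOver : NaturalUnitInterval G → ∀ {c} → IsCutVertex G c → NoEdgeOver (Adj G) c
  cutVertex⇒noEdgeOver nui (_ , _ , components , components-c , k<k') i<c c<k i~k =
    ℕ.<⇒≱ k<k' (components-≤ components components-c (λ _ → tt)
                  (Reach-without nui i<c c<k i~k))

Below : ∀ {n} {G : Graph n} → Subgraph G → Fin n → Fin n → Set
Below T c z = V T z × z ≤ c

module _ {n} {G : Graph n} (T : Subgraph G) {c : Fin n} (no-over : NoEdgeOver (E T) c) where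

  -- A walk that rises above c can only do so through c itself.
  Reach-below-or-through : ∀ {a v} → a ≤ c → Reach (E T) (V T) a v →
                           Reach (E T) (Below T c) a v ⊎ (c < v × Reach (E T) (Below T c) a c)
  Reach-below-or-through a≤c (here Va) = inj₁ (here (Va , a≤c))
  Reach-below-or-through a≤c (step {w} {v} p w~v Vv)
    with Reach-below-or-through a≤c p | v ≤? c
  ... | inj₁ a→w | yes v≤c = inj₁ (step a→w w~v (Vv , v≤c))
  ... | inj₁ a→w | no v≰c with w ≟ c
  ...   | yes refl = inj₂ (ℕ.≰⇒> v≰c , a→w)
  ...   | no w≢c   = contradiction w~v (no-over (≤∧≢⇒< (proj₂ (Reach-target a→w)) w≢c) (ℕ.≰⇒> v≰c))
  Reach-below-or-through a≤c (step {v = v} p w~v Vv)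
    | inj₂ (c<w , a→c) | yes v≤c with v ≟ c
  ...   | yes refl = inj₁ a→c
  ...   | no v≢c   = contradiction (E-sym T w~v) (no-over (≤∧≢⇒< v≤c v≢c) c<w)
  Reach-below-or-through a≤c (step p w~v Vv)
    | inj₂ (c<w , a→c) | no v≰c = inj₂ (ℕ.≰⇒> v≰c , a→c)

  Reach-below : ∀ {a b} → a ≤ c → b ≤ c → Reach (E T) (V T) a b → Reach (E T) (Below T c) a b
  Reach-below a≤c b≤c p with Reach-below-or-through a≤c p
  ... | inj₁ a→b       = a→b
  ... | inj₂ (c<b , _) = contradiction b≤c (ℕ.<⇒≱ c<b)

module _ {n} {G : Graph n} (T : Subgraph G) {σ : List (Fin n)} (σ-list : IsList T σ) where

  read-fresh : ∀ pre post → σ ≡ pre ++ post → All (λ y → V T y × y ∉ pre) post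
  read-fresh pre []         _  = []
  read-fresh pre (y ∷ post) σ≡ =
    let (Vy , y∉pre , _) , _ = proj₁ σ-list pre y post σ≡
    in  (Vy , y∉pre) ∷ All.map (λ (Vz , z∉) → Vz , z∉ ∘ ∈-++⁺ˡ) (read-fresh (pre ++ [ y ]) post σ≡′)
    where
      σ≡′ : σ ≡ (pre ++ [ y ]) ++ post
      σ≡′ = ≡.trans σ≡ (≡.sym (++-assoc pre [ y ] post))

edge-from-read⇒candidate : ∀ {n} {G : Graph n} (T : Subgraph G) {pre w v} →
                           w ∈ pre → v ∉ pre → E T w v → V T v → Candidate T pre v
edge-from-read⇒candidate T w∈ v∉ w~v Vv = Vv , v∉ , inj₂ (Any.map (λ { refl → w~v }) w∈)

module _ {n} {G : Graph n} (T : Subgraph G) {c : Fin n} (no-over : NoEdgeOver (E T) c)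
         (connected : ∀ u v → V T u → V T v → Reach (E T) (V T) u v)
         {σ : List (Fin n)} (σ-list : IsList T σ) where

  open DecMembership (_≟_ {n}) using (_∈?_)

  candidate-below : ∀ {pre x post u} → σ ≡ pre ++ x ∷ post → All (_≤ c) pre →
                    V T u → u ≤ c → u ∉ pre → Σ (Fin n) λ z → Candidate T pre z × z ≤ c
  candidate-below {[]} _ _ Vu u≤c _ = _ , (Vu , (λ ()) , inj₁ refl) , u≤c
  candidate-below {r ∷ pre} {x} {post} {u} σ≡ (r≤c ∷ _) Vu u≤c u∉ =
    let w , v , w∈ , v∉ , w~v , (Vv , v≤c) = Reach-exit (_∈? r ∷ pre) r→u (Any.here refl) u∉
    in  v , edge-from-read⇒candidate T w∈ v∉ w~v Vv , v≤c
    where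
      Vr : V T r
      Vr = proj₁ (proj₁ (proj₁ σ-list [] r (pre ++ x ∷ post) σ≡))

      r→u : Reach (E T) (Below T c) r u
      r→u = Reach-below T no-over r≤c u≤c (connected r u Vr Vu)

  read-all-below : ∀ {pre x post} → σ ≡ pre ++ x ∷ post → All (_≤ c) pre → ¬ x ≤ c →
                   ∀ {u} → V T u → u ≤ c → u ∈ pre
  read-all-below {pre} {x} {post} σ≡ pre≤c x≰c {u} Vu u≤c with u ∈? pre
  ... | yes u∈ = u∈
  ... | no u∉ =
    let z , z-candidate , z≤c = candidate-below σ≡ pre≤c Vu u≤c u∉
        x≤z = proj₂ (proj₁ σ-list pre x post σ≡) z z-candidate
    in  contradiction (ℕ.≤-trans x≤z z≤c) x≰c

  above-after-below : ∀ {pre post} → σ ≡ pre ++ post → All (_≤ c) pre →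
                      Maybe.All (λ x → ¬ x ≤ c) (head post) → All (c <_) post
  above-after-below {post = []}    _  _     _             = []
  above-after-below {pre} {x ∷ post} σ≡ pre≤c (Maybe.just x≰c) =
    All.map unread⇒above (read-fresh T σ-list pre (x ∷ post) σ≡)
    where
      unread⇒above : ∀ {y} → V T y × y ∉ pre → c < y
      unread⇒above (Vy , y∉) = ℕ.≰⇒> (λ y≤c → y∉ (read-all-below σ≡ pre≤c x≰c Vy y≤c))

lemma4p4 : ∀ {n : ℕ} (G : Graph n) → NaturalUnitInterval G →
    (T : Subgraph G) → IsDecreasingSubtree T →
    (c : Fin n) → V T c → IsCutVertex G c →
    (σ : List (Fin n)) → IsList T σ →
    Σ (List (Fin n)) λ pre → Σ (List (Fin n)) λ post →
    σ ≡ pre ++ post × All (λ v → v ≤ c) pre × All (λ v → c < v) post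
lemma4p4 G nui T ((_ , connected , _) , _) c _ cut σ σ-list =
  takeWhile (_≤? c) σ , dropWhile (_≤? c) σ , σ≡ , all-takeWhile (_≤? c) σ ,
  above-after-below T no-over connected σ-list σ≡ (all-takeWhile (_≤? c) σ) (all-head-dropWhile (_≤? c) σ)
  where
    σ≡ : σ ≡ takeWhile (_≤? c) σ ++ dropWhile (_≤? c) σ
    σ≡ = ≡.sym (takeWhile++dropWhile (_≤? c) σ)
    no-over : NoEdgeOver (E T) c
    no-over i<c c<k e = cutVertex⇒noEdgeOver G nui cut i<c c<k (E⊆G T e)
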